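{- Consider the algorithm $\mathcal{P}$ described in the context. If a fixed (non-adaptively chosen) insert-only stream of a graph $G$ on $[n]$ with maximum degree $\Delta \le L$ (no edge repeated) is provided to $\mathcal{P}$, then with high probability the total number of edges stored by $\mathcal{P}$ in its set $A$ is $O(n(\log n)^3)$.
   Context: $\log$ is base 2; "with high probability" means with probability at least $1 - 1/\mathrm{poly}(n)$. Algorithm $\mathcal{P}$ (parameters $n$ and a known degree bound $L$). Random bits: for each vertex $x \in [n]$ and each $i \in [L]$, independently, $P^i_x$ is a list of $4\log n$ colors sampled uniformly at random with replacement from $[2i^2]$. Initialization: for each vertex $x$, $\mathrm{deg}(x) = 0$ and $\mathrm{clr}(x) = (0,0)$; $A$ is an empty set of edges. Processing an edge $\{u,v\}$: increase $\mathrm{deg}(u)$ and $\mathrm{deg}(v)$ by one; let $k = \max\{\mathrm{deg}(u),\mathrm{deg}(v)\}$; if for some $i \in \{k,\dots,L\}$ the lists $P^i_u$ and $P^i_v$ share a color, add $\{u,v\}$ to $A$. Then let $\mathrm{used} = \{\mathrm{clr}(w) : \{u,w\} \in A\}$; for $j = 1,\dots,4\log n$, let $c = (\mathrm{deg}(u), P^{\mathrm{deg}(u)}_u[j])$ and if $c \notin \mathrm{used}$, set $\mathrm{clr}(u) = c$ and stop processing this edge; if no $j$ succeeds, abort. Query: return the vector $\mathrm{clr}$. -}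

module Defs where

open import Data.Nat using (ℕ; zero; suc; _+_; _*_; _∸_; _⊔_; _≤_; _<ᵇ_; _≡ᵇ_)
open import Data.Nat.Logarithm using (⌈log₂_⌉)
open import Data.Bool using (Bool; true; false; if_then_else_; _∧_; _∨_; not)
open import Data.Bool.ListAction using (any)
open import Data.Fin using (Fin; toℕ)
open import Data.Fin.Properties using () renaming (_≟_ to _≟F_)
open import Data.List using (List; []; _∷_; _++_; map; length; upTo; filterᵇ; foldl; allFin; concatMap; cartesianProductWith)
open import Data.Vec using (Vec; toList)
import Data.Vec as V
open import Data.Product using (_×_; _,_; proj₁; proj₂)
open import Data.Unit using (⊤; tt)
open import Data.Sum using (_⊎_)
open import Data.List.Relation.Unary.All using (All)
open import Data.List.Relation.Unary.AllPairs using (AllPairs)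
open import Relation.Nullary using (¬_; does)
open import Relation.Binary.PropositionalEquality using (_≡_; _≢_)

-- Random bits of algorithm P.
-- Row L K : for i = 1..L, a list (Vec) of K colours, the i-th drawn
-- from [2 i^2]; a colour is stored as Fin (2 i^2) and read as 1 + toℕ.

Row : ℕ → ℕ → Set
Row zero    K = ⊤
Row (suc i) K = Row i K × Vec (Fin (2 * (suc i * suc i))) K

-- P^i as a list of colours in {1,…,2i²}; [] for i ∉ [L]
rowGet : ∀ {L K} → Row L K → ℕ → List ℕ
rowGet {zero}  _       i = []
rowGet {suc L} (r , v) i =
  if i ≡ᵇ suc L then map (λ c → suc (toℕ c)) (toList v) else rowGet r i

Tape : ℕ → ℕ → ℕ → Set
Tape n L K = Vec (Row L K) n

Klen : ℕ → ℕ
Klen n = 4 * ⌈log₂ n ⌉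

allVec : ∀ {A : Set} → List A → (k : ℕ) → List (Vec A k)
allVec xs zero    = V.[] ∷ []
allVec xs (suc k) = cartesianProductWith V._∷_ xs (allVec xs k)

allRows : (L K : ℕ) → List (Row L K)
allRows zero    K = tt ∷ []
allRows (suc L) K = cartesianProductWith _,_ (allRows L K) (allVec (allFin _) K)

allTapes : (n L K : ℕ) → List (Tape n L K)
allTapes n L K = allVec (allRows L K) n

Colour : Set
Colour = ℕ × ℕ

_==F_ : ∀ {n} → Fin n → Fin n → Bool
x ==F y = does (x ≟F y)

_==C_ : Colour → Colour → Bool
(a , b) ==C (c , d) = (a ≡ᵇ c) ∧ (b ≡ᵇ d)

memN : ℕ → List ℕ → Bool
memN x ys = any (λ y → x ≡ᵇ y) ys

memC : Colour → List Colour → Bool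
memC c cs = any (λ d → c ==C d) cs

record State (n : ℕ) : Set where
  constructor st
  field
    deg   : Fin n → ℕ
    clr   : Fin n → Colour
    A     : List (Fin n × Fin n)
    alive : Bool            -- false once the algorithm has aborted
open State public

initState : ∀ {n} → State n
initState = st (λ _ → 0) (λ _ → (0 , 0)) [] true

firstFree : List Colour → List Colour → Bool × Colour
firstFree used []       = false , (0 , 0)
firstFree used (c ∷ cs) = if memC c used then firstFree used cs else (true , c)

step : ∀ {n L K} → Tape n L K → State n → Fin n × Fin n → State n
step {n} {L} P s (u , v) = if alive s then go else s
  where
    Pl : Fin n → ℕ → List ℕ
    Pl x i = rowGet (V.lookup P x) i
    deg' : Fin n → ℕ
    deg' x = deg s x + (if x ==F u then 1 else 0) + (if x ==F v then 1 else 0)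
    k : ℕ
    k = deg' u ⊔ deg' v
    share : ℕ → Bool
    share i = any (λ c → memN c (Pl v i)) (Pl u i)
    addA : Bool
    addA = any share (map (k +_) (upTo (suc L ∸ k)))   -- i ∈ {k,…,L}
    A' : List (Fin n × Fin n)
    A' = if addA then A s ++ ((u , v) ∷ []) else A s
    nbrClr : Fin n × Fin n → List Colour
    nbrClr (a , b) = if a ==F u then clr s b ∷ []
                     else (if b ==F u then clr s a ∷ [] else [])
    used : List Colour
    used = concatMap nbrClr A'
    res : Bool × Colour
    res = firstFree used (map (λ c → (deg' u , c)) (Pl u (deg' u)))
    clr' : Fin n → Colour
    clr' x = if x ==F u then proj₂ res else clr s x
    go : State n
    go = if proj₁ res then st deg' clr' A' true else st deg' (clr s) A' false

run : ∀ {n L K} → Tape n L K → List (Fin n × Fin n) → State n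
run P es = foldl (step P) initState es

-- |A| at the end of the stream (or at the moment of abort)
storedEdges : ∀ {n L K} → Tape n L K → List (Fin n × Fin n) → ℕ
storedEdges P es = length (A (run P es))

SameEdge : ∀ {n} → Fin n × Fin n → Fin n × Fin n → Set
SameEdge (a , b) (c , d) = ((a ≡ c) × (b ≡ d)) ⊎ ((a ≡ d) × (b ≡ c))

degIn : ∀ {n} → List (Fin n × Fin n) → Fin n → ℕ
degIn es x = length (filterᵇ (λ e → (proj₁ e ==F x) ∨ (proj₂ e ==F x)) es)

record ValidStream (n L : ℕ) (es : List (Fin n × Fin n)) : Set where
  field
    noLoops    : All (λ e → proj₁ e ≢ proj₂ e) es
    noRepeat   : AllPairs (λ e f → ¬ SameEdge e f) es
    maxDegree  : ∀ x → degIn es x ≤ L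

badCount : (n L : ℕ) → List (Fin n × Fin n) → ℕ → ℕ
badCount n L es bound =
  length (filterᵇ (λ P → bound <ᵇ storedEdges P es) (allTapes n L (Klen n)))

totalCount : (n L : ℕ) → ℕ
totalCount n L = length (allTapes n L (Klen n))

-- An edge {u,v} can only be stored if the lists of u and v share a colour at some level
-- i ≥ k, and whether this test passes depends only on the degrees, not on the colouring or
-- on an abort.  So it suffices to bound the number of passing edges, counted as Σᵤ Xᵤ where
-- Xᵤ counts the passing edges whose first endpoint in the stream is u.  Fix the row c of u.
-- When the edge to a new neighbour v arrives after j earlier edges at u, we have k ≥ j + 1,
-- and by a union bound over the levels and the colours the independent row of v passes with
-- probability at most Σ_{i ≥ k} K²/(2i²) ≤ K²/k.  The rows of distinct neighbours are
-- independent, so E[2^Xᵤ | c] ≤ Πⱼ (1 + K²/(j+1)) ≤ Πⱼ ((j+2)/(j+1))^(K²) ≤ (n+1)^(K²).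
-- With K = 4⌈log₂ n⌉ and m = 34⌈log₂ n⌉³, Markov's inequality and a union bound over u show
-- that some Xᵤ exceeds m with probability at most 1/n; otherwise at most n·m edges are stored.

module Submission where

open import Defs
open import Data.Bool using (Bool; true; false; if_then_else_; _∧_; _∨_; T)
open import Data.Bool.ListAction using (any)
open import Data.Empty using (⊥-elim)
open import Data.Fin using (Fin; zero; suc; toℕ)
open import Data.Fin.Properties using () renaming (_≟_ to _≟ᶠ_; suc-injective to sucᶠ-injective)
open import Data.List using (List; []; _∷_; _++_; map; length; upTo; filterᵇ; foldl; allFin; tabulate; cartesianProductWith)
open import Data.List.Properties using (length-++; length-map; length-tabulate; map-upTo)
open import Data.List.Relation.Unary.All using (All; []; _∷_)
open import Data.List.Relation.Unary.AllPairs using (AllPairs; []; _∷_)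
open import Data.Nat using (ℕ; zero; suc; _+_; _*_; _^_; _∸_; _⊔_; _≤_; _<_; z≤n; s≤s; _≡ᵇ_; _<ᵇ_; ⌈_/2⌉; >-nonZero)
open import Data.Nat.Induction using (<-wellFounded)
open import Data.Nat.Logarithm using (⌈log₂_⌉; ⌈log₂⌉-mono-≤; ⌈log₂2^n⌉≡n)
open import Data.Nat.Logarithm.Core using (⌈log2⌉)
open import Data.Nat.Properties
open import Data.Nat.Tactic.RingSolver using (solve-∀)
open import Data.Product using (Σ; _×_; _,_; proj₁; proj₂)
open import Data.Sum using (inj₁)
open import Data.Vec using (Vec; toList)
import Data.Vec as Vec
open import Data.Vec.Properties using (length-toList)
open import Function using (_∘_; case_of_)
open import Induction.WellFounded using (Acc; acc)
open import Relation.Binary.PropositionalEquality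
open import Relation.Nullary using (¬_; yes; no)
open import Relation.Nullary.Decidable using (dec-true; dec-false)

open import Algebra.Properties.CommutativeMonoid.Sum +-0-commutativeMonoid
  using (sum; sum-syntax; sum-cong-≗; sum-replicate-zero)
  renaming (∑-distrib-+ to sum-distrib-+)
open import Algebra.Properties.Monoid.Sum *-1-monoid
  using () renaming (sum to ∏; sum-cong-≗ to ∏-cong-≗)

private variable X Y Z : Set

𝟙 : Bool → ℕ
𝟙 b = if b then 1 else 0

𝟙≤1 : ∀ b → 𝟙 b ≤ 1
𝟙≤1 true  = s≤s z≤n
𝟙≤1 false = z≤n

𝟙-∨ : ∀ a b → 𝟙 (a ∨ b) ≤ 𝟙 a + 𝟙 b
𝟙-∨ true  b = s≤s z≤n
𝟙-∨ false b = ≤-refl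

𝟙-∧ : ∀ a b → 𝟙 (a ∧ b) ≡ (if a then 𝟙 b else 0)
𝟙-∧ true  b = refl
𝟙-∧ false b = refl

𝟙-∨-disjoint : ∀ a b → (a ≡ true → b ≡ false) → 𝟙 (a ∨ b) ≡ 𝟙 b + 𝟙 a
𝟙-∨-disjoint true  b a⇒¬b rewrite a⇒¬b refl = refl
𝟙-∨-disjoint false b _    = sym (+-identityʳ _)

∑ : List X → (X → ℕ) → ℕ
∑ []       f = 0
∑ (x ∷ xs) f = f x + ∑ xs f

infixl 10 ∑
syntax ∑ xs (λ x → e) = ∑[ x ∈ xs ] e

module _ {f g : X → ℕ} where

  ∑-cong : ∀ xs → (∀ x → f x ≡ g x) → ∑ xs f ≡ ∑ xs g
  ∑-cong []       f≗g = refl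
  ∑-cong (x ∷ xs) f≗g = cong₂ _+_ (f≗g x) (∑-cong xs f≗g)

  ∑-mono-≤ : ∀ xs → (∀ x → f x ≤ g x) → ∑ xs f ≤ ∑ xs g
  ∑-mono-≤ []       f≤g = z≤n
  ∑-mono-≤ (x ∷ xs) f≤g = +-mono-≤ (f≤g x) (∑-mono-≤ xs f≤g)

  ∑-distrib-+ : ∀ xs → ∑[ x ∈ xs ] (f x + g x) ≡ ∑ xs f + ∑ xs g
  ∑-distrib-+ []       = refl
  ∑-distrib-+ (x ∷ xs) = begin
    f x + g x + ∑[ y ∈ xs ] (f y + g y)  ≡⟨ cong (f x + g x +_) (∑-distrib-+ xs) ⟩
    f x + g x + (∑ xs f + ∑ xs g)        ≡⟨ +-assoc-comm (f x) (g x) (∑ xs f) (∑ xs g) ⟩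
    f x + ∑ xs f + (g x + ∑ xs g)        ∎
    where
    open ≡-Reasoning
    +-assoc-comm : ∀ a b c d → a + b + (c + d) ≡ a + c + (b + d)
    +-assoc-comm = solve-∀

∑-++ : ∀ (f : X → ℕ) xs ys → ∑ (xs ++ ys) f ≡ ∑ xs f + ∑ ys f
∑-++ f []       ys = refl
∑-++ f (x ∷ xs) ys = trans (cong (f x +_) (∑-++ f xs ys)) (sym (+-assoc (f x) _ _))

∑-*ˡ : ∀ c (f : X → ℕ) xs → c * ∑ xs f ≡ ∑[ x ∈ xs ] (c * f x)
∑-*ˡ c f []       = *-zeroʳ c
∑-*ˡ c f (x ∷ xs) = trans (*-distribˡ-+ c (f x) _) (cong (c * f x +_) (∑-*ˡ c f xs))

∑-*ʳ : ∀ c (f : X → ℕ) xs → ∑ xs f * c ≡ ∑[ x ∈ xs ] (f x * c)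
∑-*ʳ c f xs = trans (*-comm _ c) (trans (∑-*ˡ c f xs) (∑-cong xs (λ x → *-comm c (f x))))

∑-const : ∀ c (xs : List X) → ∑[ x ∈ xs ] c ≡ length xs * c
∑-const c []       = refl
∑-const c (x ∷ xs) = cong (c +_) (∑-const c xs)

∑-zero : ∀ (xs : List X) → ∑[ x ∈ xs ] 0 ≡ 0
∑-zero xs = trans (∑-const 0 xs) (*-zeroʳ (length xs))

∑-map : ∀ (f : Y → ℕ) (g : X → Y) xs → ∑ (map g xs) f ≡ ∑ xs (f ∘ g)
∑-map f g []       = refl
∑-map f g (x ∷ xs) = cong (f (g x) +_) (∑-map f g xs)

∑-comm : ∀ (f : X → Y → ℕ) xs ys → ∑[ x ∈ xs ] ∑[ y ∈ ys ] f x y ≡ ∑[ y ∈ ys ] ∑[ x ∈ xs ] f x y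
∑-comm f []       ys = sym (∑-zero ys)
∑-comm f (x ∷ xs) ys =
  trans (cong (∑ ys (f x) +_) (∑-comm f xs ys)) (sym (∑-distrib-+ ys))

∑-cartesianProductWith : ∀ (f : Z → ℕ) (g : X → Y → Z) xs ys →
  ∑ (cartesianProductWith g xs ys) f ≡ ∑[ x ∈ xs ] ∑[ y ∈ ys ] f (g x y)
∑-cartesianProductWith f g []       ys = refl
∑-cartesianProductWith f g (x ∷ xs) ys =
  trans (∑-++ f (map (g x) ys) _) (cong₂ _+_ (∑-map f (g x) ys) (∑-cartesianProductWith f g xs ys))

∑-tabulate : ∀ {n} (f : X → ℕ) (g : Fin n → X) → ∑ (tabulate g) f ≡ ∑[ i < n ] f (g i)
∑-tabulate {n = zero}  f g = refl
∑-tabulate {n = suc n} f g = cong (f (g zero) +_) (∑-tabulate f (g ∘ suc))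

∑-upTo-suc : ∀ m (z : ℕ → ℕ) → ∑ (upTo (suc m)) z ≡ z 0 + ∑ (upTo m) (z ∘ suc)
∑-upTo-suc m z = cong (z 0 +_) (trans (cong (λ js → ∑ js z) (sym (map-upTo suc m))) (∑-map z suc (upTo m)))

length-filterᵇ≡∑ : ∀ (p : X → Bool) xs → length (filterᵇ p xs) ≡ ∑[ x ∈ xs ] 𝟙 (p x)
length-filterᵇ≡∑ p []       = refl
length-filterᵇ≡∑ p (x ∷ xs) with p x
... | true  = cong suc (length-filterᵇ≡∑ p xs)
... | false = length-filterᵇ≡∑ p xs

𝟙-any≤∑ : ∀ (p : X → Bool) xs → 𝟙 (any p xs) ≤ ∑[ x ∈ xs ] 𝟙 (p x)
𝟙-any≤∑ p []       = z≤n
𝟙-any≤∑ p (x ∷ xs) = ≤-trans (𝟙-∨ (p x) (any p xs)) (+-monoʳ-≤ (𝟙 (p x)) (𝟙-any≤∑ p xs))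

length-cartesianProductWith : ∀ (f : X → Y → Z) xs ys →
  length (cartesianProductWith f xs ys) ≡ length xs * length ys
length-cartesianProductWith f []       ys = refl
length-cartesianProductWith f (x ∷ xs) ys =
  trans (length-++ (map (f x) ys)) (cong₂ _+_ (length-map (f x) ys) (length-cartesianProductWith f xs ys))

==F⇒≡ : ∀ {n} {x y : Fin n} → (x ==F y) ≡ true → x ≡ y
==F⇒≡ {x = x} {y} with x ≟ᶠ y
... | yes x≡y = λ _ → x≡y
... | no  _   = λ ()

==F-refl : ∀ {n} (x : Fin n) → (x ==F x) ≡ true
==F-refl x = dec-true (x ≟ᶠ x) refl

≢⇒==F-false : ∀ {n} {x y : Fin n} → x ≢ y → (x ==F y) ≡ false
≢⇒==F-false {x = x} {y} = dec-false (x ≟ᶠ y)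

sum-const : ∀ n c → ∑[ i < n ] c ≡ n * c
sum-const zero    c = refl
sum-const (suc n) c = cong (c +_) (sum-const n c)

sum-mono-≤ : ∀ {n} {f g : Fin n → ℕ} → (∀ i → f i ≤ g i) → sum f ≤ sum g
sum-mono-≤ {zero}  f≤g = z≤n
sum-mono-≤ {suc n} f≤g = +-mono-≤ (f≤g zero) (sum-mono-≤ (f≤g ∘ suc))

sum-zero : ∀ {n} (f : Fin n → ℕ) → (∀ i → f i ≡ 0) → sum f ≡ 0
sum-zero {n} f f≗0 = trans (sum-cong-≗ f≗0) (sum-replicate-zero n)

sum-if : ∀ {n} b (f : Fin n → ℕ) → ∑[ i < n ] (if b then f i else 0) ≡ (if b then sum f else 0)
sum-if     true  f = refl
sum-if {n} false f = sum-replicate-zero n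

sum-pick : ∀ {n} (a : Fin n) (f : Fin n → ℕ) → ∑[ i < n ] (if a ==F i then f i else 0) ≡ f a
sum-pick {suc n} zero    f = trans (cong (f zero +_) (sum-replicate-zero n)) (+-identityʳ _)
sum-pick {suc n} (suc a) f = sum-pick a (f ∘ suc)

∑-sum-comm : ∀ {n} (f : Fin n → X → ℕ) xs → ∑[ i < n ] ∑ xs (f i) ≡ ∑[ x ∈ xs ] ∑[ i < n ] f i x
∑-sum-comm {n = zero}  f xs = sym (∑-zero xs)
∑-sum-comm {n = suc n} f xs =
  trans (cong (∑ xs (f zero) +_) (∑-sum-comm (f ∘ suc) xs)) (sym (∑-distrib-+ xs))

entry≤sum : ∀ {n} (f : Fin n → ℕ) i → f i ≤ sum f
entry≤sum f zero    = m≤m+n _ _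
entry≤sum f (suc i) = ≤-trans (entry≤sum (f ∘ suc) i) (m≤n+m _ _)

pigeonhole : ∀ {n} (f : Fin n → ℕ) m → n * m < sum f → Σ (Fin n) λ i → m < f i
pigeonhole {suc n} f m n*m<∑f with m <? f zero | n * m <? sum (f ∘ suc)
... | yes m<f₀ | _      = zero , m<f₀
... | no  _    | yes lt = let i , m<fi = pigeonhole (f ∘ suc) m lt in suc i , m<fi
... | no  m≮f₀ | no  ≮  = ⊥-elim (<⇒≱ n*m<∑f (+-mono-≤ (≮⇒≥ m≮f₀) (≮⇒≥ ≮)))

∏-const : ∀ n c → ∏ {n} (λ _ → c) ≡ c ^ n
∏-const zero    c = refl
∏-const (suc n) c = cong (c *_) (∏-const n c)

2^sum≡∏ : ∀ {n} (f : Fin n → ℕ) → 2 ^ sum f ≡ ∏ (λ i → 2 ^ f i)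
2^sum≡∏ {zero}  f = refl
2^sum≡∏ {suc n} f = trans (^-distribˡ-+-* 2 (f zero) _) (cong (2 ^ f zero *_) (2^sum≡∏ (f ∘ suc)))

∏-exchange : ∀ {n} (f g : Fin n → ℕ) j → (∀ i → i ≢ j → f i ≡ g i) → ∏ f * g j ≡ ∏ g * f j
∏-exchange {suc n} f g zero f≗g =
  trans (cong (λ p → f zero * p * g zero) (∏-cong-≗ (λ i → f≗g (suc i) λ ())))
        (swap (f zero) (∏ (g ∘ suc)) (g zero))
  where
  swap : ∀ a p b → a * p * b ≡ b * p * a
  swap = solve-∀
∏-exchange {suc n} f g (suc j) f≗g = begin
  f zero * ∏ (f ∘ suc) * g (suc j)    ≡⟨ *-assoc (f zero) _ _ ⟩
  f zero * (∏ (f ∘ suc) * g (suc j))  ≡⟨ cong₂ _*_ (f≗g zero λ ()) (∏-exchange (f ∘ suc) (g ∘ suc) j f≗g′) ⟩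
  g zero * (∏ (g ∘ suc) * f (suc j))  ≡⟨ *-assoc (g zero) _ _ ⟨
  g zero * ∏ (g ∘ suc) * f (suc j)    ∎
  where
  open ≡-Reasoning
  f≗g′ : ∀ i → i ≢ j → f (suc i) ≡ g (suc i)
  f≗g′ i i≢j = f≗g (suc i) (i≢j ∘ sucᶠ-injective)

∏-except : ∀ {n} (j : Fin n) c → ∏ (λ i → if i ==F j then 1 else c) * c ≡ c ^ n
∏-except {suc n} zero    c = trans (cong (λ p → 1 * p * c) (∏-const n c)) (rearrange c (c ^ n))
  where
  rearrange : ∀ c p → 1 * p * c ≡ c * p
  rearrange = solve-∀
∏-except {suc n} (suc j) c = trans (*-assoc c _ c) (cong (c *_) (∏-except j c))

length-allVec : ∀ (xs : List X) k → length (allVec xs k) ≡ length xs ^ k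
length-allVec xs zero    = refl
length-allVec xs (suc k) =
  trans (length-cartesianProductWith Vec._∷_ xs (allVec xs k)) (cong (length xs *_) (length-allVec xs k))

length-allFin : ∀ n → length (allFin n) ≡ n
length-allFin n = length-tabulate {n = n} (λ i → i)

rowCount : ℕ → ℕ → ℕ
rowCount L K = length (allRows L K)

rowCount-suc : ∀ L K → rowCount (suc L) K ≡ rowCount L K * (2 * (suc L * suc L)) ^ K
rowCount-suc L K = trans (length-cartesianProductWith _,_ (allRows L K) (allVec (allFin _) K))
  (cong (rowCount L K *_) (trans (length-allVec (allFin _) K) (cong (_^ K) (length-allFin _))))

rowCount>0 : ∀ L K → 0 < rowCount L K
rowCount>0 zero    K = s≤s z≤n
rowCount>0 (suc L) K = subst (0 <_) (sym (rowCount-suc L K))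
  (*-mono-≤ (rowCount>0 L K) (m^n>0 (2 * (suc L * suc L)) K))

∑-allVec-∏ : ∀ n (xs : List X) (h : Fin n → X → ℕ) →
  ∑[ Q ∈ allVec xs n ] ∏ (λ i → h i (Vec.lookup Q i)) ≡ ∏ (λ i → ∑ xs (h i))
∑-allVec-∏ zero    xs h = refl
∑-allVec-∏ (suc n) xs h = begin
  ∑[ Q ∈ allVec xs (suc n) ] ∏ (λ i → h i (Vec.lookup Q i))
    ≡⟨ ∑-cartesianProductWith _ Vec._∷_ xs (allVec xs n) ⟩
  ∑[ a ∈ xs ] ∑[ Q ∈ allVec xs n ] (h zero a * ∏ (λ i → h (suc i) (Vec.lookup Q i)))
    ≡⟨ ∑-cong xs (λ a → ∑-*ˡ (h zero a) _ (allVec xs n)) ⟨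
  ∑[ a ∈ xs ] (h zero a * ∑[ Q ∈ allVec xs n ] ∏ (λ i → h (suc i) (Vec.lookup Q i)))
    ≡⟨ ∑-cong xs (λ a → cong (h zero a *_) (∑-allVec-∏ n xs (h ∘ suc))) ⟩
  ∑[ a ∈ xs ] (h zero a * ∏ (λ i → ∑ xs (h (suc i))))
    ≡⟨ ∑-*ʳ _ (h zero) xs ⟨
  ∑ xs (h zero) * ∏ (λ i → ∑ xs (h (suc i)))  ∎
  where open ≡-Reasoning

-- Conditioning on the coordinate j: the other factors may depend on Q j.
∑-allVec-∏-conditioned : ∀ n (xs : List X) (j : Fin n) (g : X → ℕ) (h : X → Fin n → X → ℕ) →
  (∀ c b → h c j b ≡ 1) →
  ∑[ Q ∈ allVec xs n ] (g (Vec.lookup Q j) * ∏ (λ i → h (Vec.lookup Q j) i (Vec.lookup Q i)))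
    ≡ ∑[ c ∈ xs ] (g c * ∏ (λ i → if i ==F j then 1 else ∑ xs (h c i)))
∑-allVec-∏-conditioned (suc n) xs zero g h hⱼ≡1 = begin
  _ ≡⟨ ∑-cartesianProductWith _ Vec._∷_ xs (allVec xs n) ⟩
  ∑[ c ∈ xs ] ∑[ Q ∈ allVec xs n ] (g c * (h c zero c * ∏ (λ i → h c (suc i) (Vec.lookup Q i))))
    ≡⟨ ∑-cong xs (λ c → trans (sym (∑-*ˡ (g c) _ (allVec xs n)))
         (cong (g c *_) (trans (sym (∑-*ˡ (h c zero c) _ (allVec xs n)))
           (cong₂ _*_ (hⱼ≡1 c c) (∑-allVec-∏ n xs (h c ∘ suc)))))) ⟩
  ∑[ c ∈ xs ] (g c * (1 * ∏ (λ i → ∑ xs (h c (suc i))))) ∎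
  where open ≡-Reasoning
∑-allVec-∏-conditioned {X} (suc n) xs (suc j) g h hⱼ≡1 = begin
  _ ≡⟨ ∑-cartesianProductWith _ Vec._∷_ xs (allVec xs n) ⟩
  ∑[ a ∈ xs ] ∑[ Q ∈ allVec xs n ] F Q a
    ≡⟨ ∑-comm (λ a Q → F Q a) xs (allVec xs n) ⟩
  ∑[ Q ∈ allVec xs n ] ∑[ a ∈ xs ] F Q a
    ≡⟨ ∑-cong (allVec xs n) (λ Q → pull-out (g (Vec.lookup Q j)) (h (Vec.lookup Q j) zero) _) ⟩
  ∑[ Q ∈ allVec xs n ] (g′ (Vec.lookup Q j) * ∏ (λ i → h (Vec.lookup Q j) (suc i) (Vec.lookup Q i)))
    ≡⟨ ∑-allVec-∏-conditioned n xs j g′ (λ c i b → h c (suc i) b) hⱼ≡1 ⟩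
  ∑[ c ∈ xs ] (g′ c * ∏ (λ i → if i ==F j then 1 else ∑ xs (h c (suc i))))
    ≡⟨ ∑-cong xs (λ c → *-assoc (g c) _ _) ⟩
  _ ∎
  where
  open ≡-Reasoning
  F : Vec X n → X → ℕ
  F Q a = g (Vec.lookup Q j) * (h (Vec.lookup Q j) zero a * ∏ (λ i → h (Vec.lookup Q j) (suc i) (Vec.lookup Q i)))
  g′ : X → ℕ
  g′ c = g c * ∑ xs (h c zero)
  pull-out : ∀ x (y : X → ℕ) z → ∑[ a ∈ xs ] (x * (y a * z)) ≡ x * ∑ xs y * z
  pull-out x y z = begin
    ∑[ a ∈ xs ] (x * (y a * z)) ≡⟨ ∑-*ˡ x _ xs ⟨
    x * ∑[ a ∈ xs ] (y a * z)   ≡⟨ cong (x *_) (∑-*ʳ z y xs) ⟨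
    x * (∑ xs y * z)            ≡⟨ *-assoc x _ z ⟨
    x * ∑ xs y * z              ∎

colours : ∀ {N K} → Vec (Fin N) K → List ℕ
colours w = map (λ c → suc (toℕ c)) (toList w)

sum-hits≤1 : ∀ N x → ∑[ a < N ] 𝟙 (x ≡ᵇ suc (toℕ a)) ≤ 1
sum-hits≤1 zero    x             = z≤n
sum-hits≤1 (suc N) zero          = subst (_≤ 1) (sym (sum-replicate-zero (suc N))) z≤n
sum-hits≤1 (suc N) (suc zero)    = s≤s (≤-reflexive (sum-replicate-zero N))
sum-hits≤1 (suc N) (suc (suc x)) = sum-hits≤1 N (suc x)

-- Union bound: a fixed colour occurs in a uniform K-tuple over [N] with probability at most K/N.
∑-allVec-member : ∀ N K x →
  (∑[ w ∈ allVec (allFin N) K ] 𝟙 (memN x (colours w))) * N ≤ K * N ^ K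
∑-allVec-member N zero    x = z≤n
∑-allVec-member N (suc K) x = begin
  (∑[ w ∈ allVec (allFin N) (suc K) ] 𝟙 (memN x (colours w))) * N
                                ≤⟨ *-monoˡ-≤ N split ⟩
  (#tuples + N * #hits) * N     ≡⟨ distribute #tuples N #hits ⟩
  #tuples * N + N * (#hits * N) ≤⟨ +-monoʳ-≤ (#tuples * N) (*-monoʳ-≤ N (∑-allVec-member N K x)) ⟩
  #tuples * N + N * (K * N ^ K) ≡⟨ cong (λ t → t * N + N * (K * N ^ K)) #tuples≡ ⟩
  N ^ K * N + N * (K * N ^ K)   ≡⟨ collect (N ^ K) N K ⟩
  suc K * N ^ suc K             ∎
  where
  open ≤-Reasoning
  tuples : List (Vec (Fin N) K)
  tuples = allVec (allFin N) K
  #tuples #hits : ℕ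
  #tuples = length tuples
  #hits = ∑[ w ∈ tuples ] 𝟙 (memN x (colours w))
  hit : Fin N → ℕ
  hit a = 𝟙 (x ≡ᵇ suc (toℕ a))
  #tuples≡ : #tuples ≡ N ^ K
  #tuples≡ = trans (length-allVec (allFin N) K) (cong (_^ K) (length-allFin N))
  split : ∑[ w ∈ allVec (allFin N) (suc K) ] 𝟙 (memN x (colours w)) ≤ #tuples + N * #hits
  split = begin
    ∑[ w ∈ allVec (allFin N) (suc K) ] 𝟙 (memN x (colours w))
      ≡⟨ ∑-cartesianProductWith _ Vec._∷_ (allFin N) tuples ⟩
    ∑[ a ∈ allFin N ] ∑[ w ∈ tuples ] 𝟙 ((x ≡ᵇ suc (toℕ a)) ∨ memN x (colours w))
      ≤⟨ ∑-mono-≤ (allFin N) (λ a → ∑-mono-≤ tuples (λ w → 𝟙-∨ (x ≡ᵇ suc (toℕ a)) _)) ⟩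
    ∑[ a ∈ allFin N ] ∑[ w ∈ tuples ] (hit a + 𝟙 (memN x (colours w)))
      ≡⟨ ∑-cong (allFin N) (λ a → trans (∑-distrib-+ tuples) (cong (_+ #hits) (∑-const (hit a) tuples))) ⟩
    ∑[ a ∈ allFin N ] (#tuples * hit a + #hits)
      ≡⟨ ∑-distrib-+ (allFin N) ⟩
    ∑[ a ∈ allFin N ] (#tuples * hit a) + ∑[ a ∈ allFin N ] #hits
      ≡⟨ cong₂ _+_ (sym (∑-*ˡ #tuples hit (allFin N))) (trans (∑-const #hits (allFin N)) (cong (_* #hits) (length-allFin N))) ⟩
    #tuples * ∑ (allFin N) hit + N * #hits
      ≤⟨ +-monoˡ-≤ (N * #hits) (*-monoʳ-≤ #tuples (≤-trans (≤-reflexive (∑-tabulate hit (λ a → a))) (sum-hits≤1 N x))) ⟩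
    #tuples * 1 + N * #hits
      ≡⟨ cong (_+ N * #hits) (*-identityʳ #tuples) ⟩
    #tuples + N * #hits ∎
  distribute : ∀ a b c → (a + b * c) * b ≡ a * b + b * (c * b)
  distribute = solve-∀
  collect : ∀ p b k → p * b + b * (k * p) ≡ suc k * (b * p)
  collect = solve-∀

length-rowGet≤ : ∀ {L K} (r : Row L K) i → length (rowGet r i) ≤ K
length-rowGet≤ {zero}      r       i = z≤n
length-rowGet≤ {suc L} {K} (r , w) i with i ≡ᵇ suc L
... | true  = ≤-reflexive (trans (length-map _ (toList w)) (length-toList w))
... | false = length-rowGet≤ r i

∑-allRows-member : ∀ L K i x → 1 ≤ i → i ≤ L →
  (∑[ r ∈ allRows L K ] 𝟙 (memN x (rowGet r i))) * (2 * (i * i)) ≤ K * rowCount L K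
∑-allRows-member zero    K .zero x () z≤n
∑-allRows-member (suc L) K i x 1≤i i≤L with i ≡ᵇ suc L in eq
... | true = begin
  _                          ≡⟨ cong₂ _*_ count (cong (λ j → 2 * (j * j)) i≡) ⟩
  rowCount L K * #hits * N   ≡⟨ *-assoc (rowCount L K) #hits N ⟩
  rowCount L K * (#hits * N) ≤⟨ *-monoʳ-≤ (rowCount L K) (∑-allVec-member N K x) ⟩
  rowCount L K * (K * N ^ K) ≡⟨ rearrange (rowCount L K) K (N ^ K) ⟩
  K * (rowCount L K * N ^ K) ≡⟨ cong (K *_) (rowCount-suc L K) ⟨
  K * rowCount (suc L) K     ∎
  where
  open ≤-Reasoning
  N : ℕ
  N = 2 * (suc L * suc L)
  tuples : List (Vec (Fin N) K)
  tuples = allVec (allFin N) K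
  #hits : ℕ
  #hits = ∑[ w ∈ tuples ] 𝟙 (memN x (colours w))
  count : ∑[ r ∈ allRows (suc L) K ] 𝟙 (memN x (colours (proj₂ r))) ≡ rowCount L K * #hits
  count = trans (∑-cartesianProductWith _ _,_ (allRows L K) tuples) (∑-const #hits (allRows L K))
  i≡ : i ≡ suc L
  i≡ = ≡ᵇ⇒≡ i (suc L) (subst T (sym eq) _)
  rearrange : ∀ a b c → a * (b * c) ≡ b * (a * c)
  rearrange = solve-∀
... | false = begin
  _                                       ≡⟨ cong (_* (2 * (i * i))) count ⟩
  length tuples * #hits * (2 * (i * i))   ≡⟨ *-assoc (length tuples) #hits _ ⟩
  length tuples * (#hits * (2 * (i * i))) ≤⟨ *-monoʳ-≤ (length tuples) (∑-allRows-member L K i x 1≤i i≤L′) ⟩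
  length tuples * (K * rowCount L K)      ≡⟨ rearrange (length tuples) K (rowCount L K) ⟩
  K * (rowCount L K * length tuples)      ≡⟨ cong (K *_) (length-cartesianProductWith _,_ (allRows L K) tuples) ⟨
  K * rowCount (suc L) K                  ∎
  where
  open ≤-Reasoning
  tuples : List (Vec (Fin (2 * (suc L * suc L))) K)
  tuples = allVec (allFin _) K
  #hits : ℕ
  #hits = ∑[ r ∈ allRows L K ] 𝟙 (memN x (rowGet r i))
  count : ∑[ r ∈ allRows (suc L) K ] 𝟙 (memN x (rowGet (proj₁ r) i)) ≡ length tuples * #hits
  count = begin-equality
    ∑[ r ∈ allRows (suc L) K ] 𝟙 (memN x (rowGet (proj₁ r) i))
      ≡⟨ ∑-cartesianProductWith _ _,_ (allRows L K) tuples ⟩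
    ∑[ r ∈ allRows L K ] ∑[ w ∈ tuples ] 𝟙 (memN x (rowGet r i))
      ≡⟨ ∑-cong (allRows L K) (λ r → ∑-const _ tuples) ⟩
    ∑[ r ∈ allRows L K ] (length tuples * 𝟙 (memN x (rowGet r i)))
      ≡⟨ ∑-*ˡ (length tuples) _ (allRows L K) ⟨
    length tuples * #hits ∎
  i≤L′ : i ≤ L
  i≤L′ = ≤-pred (≤∧≢⇒< i≤L (λ i≡ → subst T eq (≡⇒≡ᵇ i (suc L) i≡)))
  rearrange : ∀ a b c → a * (b * c) ≡ b * (c * a)
  rearrange = solve-∀

-- Since (2t+1)(2t+3) + 1 = 4(t+1)², we have 1/(2(t+1)²) ≤ 1/(2t+1) − 1/(2t+3).
inverse-square-step : ∀ t y S Q → y * (2 * (suc t * suc t)) ≤ Q → (2 * suc t + 1) * S ≤ Q →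
  (2 * t + 1) * (y + S) ≤ Q
inverse-square-step t y S Q y≤ S≤ = *-cancelˡ-≤ b (begin
  b * (a * (y + S))            ≡⟨ expand t y S ⟩
  b * a * y + a * (b * S)      ≤⟨ +-mono-≤ (*-monoˡ-≤ y ba≤) (*-monoʳ-≤ a S≤) ⟩
  4 * (suc t * suc t) * y + a * Q ≡⟨ cong (_+ a * Q) (regroup t y) ⟩
  2 * (y * (2 * (suc t * suc t))) + a * Q ≤⟨ +-monoˡ-≤ (a * Q) (*-monoʳ-≤ 2 y≤) ⟩
  2 * Q + a * Q                ≡⟨ collect t Q ⟩
  b * Q                        ∎)
  where
  open ≤-Reasoning
  a b : ℕ
  a = 2 * t + 1
  b = 2 * suc t + 1
  ba≤ : b * a ≤ 4 * (suc t * suc t)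
  ba≤ = ≤-trans (m≤m+n (b * a) 1) (≤-reflexive (product t))
    where
    product : ∀ t → (2 * suc t + 1) * (2 * t + 1) + 1 ≡ 4 * (suc t * suc t)
    product = solve-∀
  expand : ∀ t y S → (2 * suc t + 1) * ((2 * t + 1) * (y + S)) ≡ (2 * suc t + 1) * (2 * t + 1) * y + (2 * t + 1) * ((2 * suc t + 1) * S)
  expand = solve-∀
  regroup : ∀ t y → 4 * (suc t * suc t) * y ≡ 2 * (y * (2 * (suc t * suc t)))
  regroup = solve-∀
  collect : ∀ t Q → 2 * Q + (2 * t + 1) * Q ≡ (2 * suc t + 1) * Q
  collect = solve-∀

inverse-square-tail : ∀ m t (z : ℕ → ℕ) Q →
  (∀ j → j < m → z j * (2 * ((suc t + j) * (suc t + j))) ≤ Q) →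
  (2 * t + 1) * ∑ (upTo m) z ≤ Q
inverse-square-tail zero    t z Q z≤ = subst (_≤ Q) (sym (*-zeroʳ (2 * t + 1))) z≤n
inverse-square-tail (suc m) t z Q z≤ =
  subst (λ s → (2 * t + 1) * s ≤ Q) (sym (∑-upTo-suc m z))
    (inverse-square-step t (z 0) _ Q first (inverse-square-tail m (suc t) (z ∘ suc) Q rest))
  where
  first : z 0 * (2 * (suc t * suc t)) ≤ Q
  first = subst (λ i → z 0 * (2 * (i * i)) ≤ Q) (+-identityʳ (suc t)) (z≤ 0 (s≤s z≤n))
  rest : ∀ j → j < m → z (suc j) * (2 * ((suc (suc t) + j) * (suc (suc t) + j))) ≤ Q
  rest j j<m = subst (λ i → z (suc j) * (2 * (i * i)) ≤ Q) (+-suc (suc t) j) (z≤ (suc j) (s≤s j<m))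

<∸⇒+< : ∀ m k j → j < m ∸ k → k + j < m
<∸⇒+< m       zero    j j<m   = j<m
<∸⇒+< (suc m) (suc k) j j<m∸k = s≤s (<∸⇒+< m k j j<m∸k)

sharesFrom : ∀ {L K} → Row L K → Row L K → ℕ → Bool
sharesFrom {L} c r k = any (λ i → any (λ x → memN x (rowGet r i)) (rowGet c i)) (map (k +_) (upTo (suc L ∸ k)))

-- Union bound over the levels i ≥ k and the colours of c, then inverse-square-tail.
sharesFrom-count : ∀ L K (c : Row L K) k → 1 ≤ k →
  (∑[ r ∈ allRows L K ] 𝟙 (sharesFrom c r k)) * k ≤ rowCount L K * (K * K)
sharesFrom-count L K c k@(suc t) _ = begin
  (∑[ r ∈ rows ] 𝟙 (sharesFrom c r k)) * k   ≤⟨ *-monoˡ-≤ k per-level ⟩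
  ∑ (upTo m) (y ∘ (k +_)) * k                ≡⟨ *-comm _ k ⟩
  k * ∑ (upTo m) (y ∘ (k +_))                ≤⟨ *-monoˡ-≤ _ k≤ ⟩
  (2 * t + 1) * ∑ (upTo m) (y ∘ (k +_))      ≤⟨ inverse-square-tail m t (y ∘ (k +_)) Q level-bound ⟩
  Q                                          ≡⟨ rearrange K (rowCount L K) ⟩
  rowCount L K * (K * K)                     ∎
  where
  open ≤-Reasoning
  rows : List (Row L K)
  rows = allRows L K
  m Q : ℕ
  m = suc L ∸ k
  Q = K * (K * rowCount L K)
  sharesAt : ℕ → Row L K → Bool
  sharesAt i r = any (λ x → memN x (rowGet r i)) (rowGet c i)
  y : ℕ → ℕ
  y i = ∑[ r ∈ rows ] 𝟙 (sharesAt i r)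
  per-level : ∑[ r ∈ rows ] 𝟙 (sharesFrom c r k) ≤ ∑ (upTo m) (y ∘ (k +_))
  per-level = begin
    ∑[ r ∈ rows ] 𝟙 (sharesFrom c r k)
      ≤⟨ ∑-mono-≤ rows (λ r → 𝟙-any≤∑ (λ i → sharesAt i r) (map (k +_) (upTo m))) ⟩
    ∑[ r ∈ rows ] ∑[ i ∈ map (k +_) (upTo m) ] 𝟙 (sharesAt i r)
      ≡⟨ ∑-comm _ rows (map (k +_) (upTo m)) ⟩
    ∑ (map (k +_) (upTo m)) y
      ≡⟨ ∑-map y (k +_) (upTo m) ⟩
    ∑ (upTo m) (y ∘ (k +_)) ∎
  y-bound : ∀ i → 1 ≤ i → i ≤ L → y i * (2 * (i * i)) ≤ Q
  y-bound i 1≤i i≤L = begin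
    y i * Nᵢ
      ≤⟨ *-monoˡ-≤ Nᵢ (∑-mono-≤ rows (λ r → 𝟙-any≤∑ (λ x → memN x (rowGet r i)) (rowGet c i))) ⟩
    (∑[ r ∈ rows ] ∑[ x ∈ rowGet c i ] 𝟙 (memN x (rowGet r i))) * Nᵢ
      ≡⟨ cong (_* Nᵢ) (∑-comm _ rows (rowGet c i)) ⟩
    (∑[ x ∈ rowGet c i ] ∑[ r ∈ rows ] 𝟙 (memN x (rowGet r i))) * Nᵢ
      ≡⟨ ∑-*ʳ Nᵢ _ (rowGet c i) ⟩
    ∑[ x ∈ rowGet c i ] ((∑[ r ∈ rows ] 𝟙 (memN x (rowGet r i))) * Nᵢ)
      ≤⟨ ∑-mono-≤ (rowGet c i) (λ x → ∑-allRows-member L K i x 1≤i i≤L) ⟩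
    ∑[ x ∈ rowGet c i ] (K * rowCount L K)
      ≡⟨ ∑-const _ (rowGet c i) ⟩
    length (rowGet c i) * (K * rowCount L K)
      ≤⟨ *-monoˡ-≤ _ (length-rowGet≤ c i) ⟩
    Q ∎
    where
    Nᵢ : ℕ
    Nᵢ = 2 * (i * i)
  level-bound : ∀ j → j < m → y (k + j) * (2 * ((k + j) * (k + j))) ≤ Q
  level-bound j j<m = y-bound (k + j) (s≤s z≤n) (≤-pred (<∸⇒+< (suc L) k j j<m))
  k≤ : k ≤ 2 * t + 1
  k≤ = ≤-trans (m≤m+n k t) (≤-reflexive (double t))
    where
    double : ∀ t → suc t + t ≡ 2 * t + 1
    double = solve-∀
  rearrange : ∀ K R → K * (K * R) ≡ R * (K * K)
  rearrange = solve-∀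

Edge : ℕ → Set
Edge n = Fin n × Fin n

bumpDegrees : ∀ {n} → (Fin n → ℕ) → Edge n → Fin n → ℕ
bumpDegrees d (u , v) x = d x + 𝟙 (x ==F u) + 𝟙 (x ==F v)

level : ∀ {n} → (Fin n → ℕ) → Edge n → ℕ
level d (u , v) = bumpDegrees d (u , v) u ⊔ bumpDegrees d (u , v) v

row : ∀ {n L K} → Tape n L K → Fin n → Row L K
row = Vec.lookup

A-if : ∀ {n} b {d₁ d₂ c₁ c₂} {a : List (Edge n)} {t₁ t₂} → A (if b then st d₁ c₁ a t₁ else st d₂ c₂ a t₂) ≡ a
A-if true  = refl
A-if false = refl

deg-if : ∀ {n} b {d c₁ c₂} {a₁ a₂ : List (Edge n)} {t₁ t₂} → deg (if b then st d c₁ a₁ t₁ else st d c₂ a₂ t₂) ≡ d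
deg-if true  = refl
deg-if false = refl

passingPair : ∀ {n L K} → Fin n → Fin n → Row L K → Row L K → (Fin n → ℕ) → List (Edge n) → ℕ
passingPair u v c r d []             = 0
passingPair u v c r d ((a , b) ∷ es) =
  𝟙 ((a ==F u) ∧ ((b ==F v) ∧ sharesFrom c r (level d (a , b)))) + passingPair u v c r (bumpDegrees d (a , b)) es

module _ {n L K} (P : Tape n L K) where

  passes : (Fin n → ℕ) → Edge n → Bool
  passes d (u , v) = sharesFrom (row P u) (row P v) (level d (u , v))

  passingCount : (Fin n → ℕ) → List (Edge n) → ℕ
  passingCount d []       = 0
  passingCount d (e ∷ es) = 𝟙 (passes d e) + passingCount (bumpDegrees d e) es

  -- The success flag of the colouring inside `step`: A and deg are updated alike either way.
  colourFound : (Fin n → ℕ) → Edge n → List Colour → Bool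
  colourFound d (u , v) used = proj₁ (firstFree used (map (λ x → (bumpDegrees d (u , v) u , x)) (rowGet (row P u) (bumpDegrees d (u , v) u))))

  A-step : ∀ d c a e → A (step P (st d c a true) e) ≡ (if passes d e then a ++ (e ∷ []) else a)
  A-step d c a e = A-if (colourFound d e _)

  deg-step : ∀ d c a e → deg (step P (st d c a true) e) ≡ bumpDegrees d e
  deg-step d c a e = deg-if (colourFound d e _)

  foldl-dead : ∀ d c a es → foldl (step P) (st d c a false) es ≡ st d c a false
  foldl-dead d c a []       = refl
  foldl-dead d c a (e ∷ es) = foldl-dead d c a es

  length-A-foldl≤ : ∀ s es → length (A (foldl (step P) s es)) ≤ length (A s) + passingCount (deg s) es
  length-A-foldl≤ s                []       = m≤m+n _ _
  length-A-foldl≤ (st d c a false) (e ∷ es) rewrite foldl-dead d c a (e ∷ es) = m≤m+n _ _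
  length-A-foldl≤ (st d c a true)  (e ∷ es) = begin
    length (A (foldl (step P) s′ es))
      ≤⟨ length-A-foldl≤ s′ es ⟩
    length (A s′) + passingCount (deg s′) es
      ≡⟨ cong₂ (λ as d′ → length as + passingCount d′ es) (A-step d c a e) (deg-step d c a e) ⟩
    length (if passes d e then a ++ e ∷ [] else a) + passingCount (bumpDegrees d e) es
      ≡⟨ cong (_+ passingCount (bumpDegrees d e) es) (length-snoc-if (passes d e)) ⟩
    length a + 𝟙 (passes d e) + passingCount (bumpDegrees d e) es
      ≡⟨ +-assoc (length a) _ _ ⟩
    length a + passingCount d (e ∷ es) ∎
    where
    open ≤-Reasoning
    s′ : State n
    s′ = step P (st d c a true) e
    length-snoc-if : ∀ b → length (if b then a ++ e ∷ [] else a) ≡ length a + 𝟙 b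
    length-snoc-if true  = length-++ a
    length-snoc-if false = sym (+-identityʳ _)

  storedEdges≤passingCount : ∀ es → storedEdges P es ≤ passingCount (λ _ → 0) es
  storedEdges≤passingCount = length-A-foldl≤ initState

  passingFrom : Fin n → (Fin n → ℕ) → List (Edge n) → ℕ
  passingFrom u d es = ∑[ v < n ] passingPair u v (row P u) (row P v) d es

  passingCount≡∑passingFrom : ∀ d es → passingCount d es ≡ ∑[ u < n ] passingFrom u d es
  passingCount≡∑passingFrom d []             = sym (sum-zero (λ u → passingFrom u d []) (λ u → sum-replicate-zero n))
  passingCount≡∑passingFrom d ((a , b) ∷ es) = begin
    𝟙 (passes d (a , b)) + passingCount d′ es
      ≡⟨ cong₂ _+_ (sym first-edge) (passingCount≡∑passingFrom d′ es) ⟩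
    ∑[ u < n ] ∑[ v < n ] H u v + ∑[ u < n ] passingFrom u d′ es
      ≡⟨ sum-distrib-+ (λ u → ∑[ v < n ] H u v) (λ u → passingFrom u d′ es) ⟨
    ∑[ u < n ] (∑[ v < n ] H u v + passingFrom u d′ es)
      ≡⟨ sum-cong-≗ (λ u → sum-distrib-+ (H u) (λ v → passingPair u v (row P u) (row P v) d′ es)) ⟨
    ∑[ u < n ] passingFrom u d ((a , b) ∷ es) ∎
    where
    open ≡-Reasoning
    d′ : Fin n → ℕ
    d′ = bumpDegrees d (a , b)
    S : Fin n → Fin n → Bool
    S u v = sharesFrom (row P u) (row P v) (level d (a , b))
    H : Fin n → Fin n → ℕ
    H u v = 𝟙 ((a ==F u) ∧ ((b ==F v) ∧ S u v))
    first-edge : ∑[ u < n ] ∑[ v < n ] H u v ≡ 𝟙 (S a b)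
    first-edge = begin
      ∑[ u < n ] ∑[ v < n ] H u v
        ≡⟨ sum-cong-≗ (λ u → trans (sum-cong-≗ (λ v → 𝟙-∧ (a ==F u) ((b ==F v) ∧ S u v)))
                                   (sum-if (a ==F u) (λ v → 𝟙 ((b ==F v) ∧ S u v)))) ⟩
      ∑[ u < n ] (if a ==F u then ∑[ v < n ] 𝟙 ((b ==F v) ∧ S u v) else 0)
        ≡⟨ sum-pick a _ ⟩
      ∑[ v < n ] 𝟙 ((b ==F v) ∧ S a v)
        ≡⟨ sum-cong-≗ (λ v → 𝟙-∧ (b ==F v) (S a v)) ⟩
      ∑[ v < n ] (if b ==F v then 𝟙 (S a v) else 0)
        ≡⟨ sum-pick b _ ⟩
      𝟙 (S a b) ∎

^-distribʳ-* : ∀ a b m → (a * b) ^ m ≡ a ^ m * b ^ m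
^-distribʳ-* a b zero    = refl
^-distribʳ-* a b (suc m) = trans (cong (a * b *_) (^-distribʳ-* a b m)) (interchange a b (a ^ m) (b ^ m))
  where
  interchange : ∀ a b p q → a * b * (p * q) ≡ a * p * (b * q)
  interchange = solve-∀

-- Bernoulli's inequality (1 + 1/(x+1))^M ≥ 1 + M/(x+1), cleared of denominators.
bernoulli : ∀ x M → (x + 1) ^ M * (x + 1 + M) ≤ (x + 2) ^ M * (x + 1)
bernoulli x zero    = ≤-reflexive (cong (1 *_) (+-identityʳ (x + 1)))
bernoulli x (suc M) = begin
  a * p * (a + suc M)        ≡⟨ expand a p M ⟩
  a * (p * (a + M)) + a * p  ≤⟨ +-mono-≤ (*-monoʳ-≤ a (bernoulli x M)) (*-monoʳ-≤ a p≤q) ⟩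
  a * (q * a) + a * q        ≡⟨ collect x q ⟩
  (x + 2) * q * a            ∎
  where
  open ≤-Reasoning
  a p q : ℕ
  a = x + 1
  p = a ^ M
  q = (x + 2) ^ M
  p≤q : p ≤ q
  p≤q = ^-monoˡ-≤ M (+-monoʳ-≤ x (s≤s z≤n))
  expand : ∀ a p M → a * p * (a + suc M) ≡ a * (p * (a + M)) + a * p
  expand = solve-∀
  collect : ∀ x q → (x + 1) * (q * (x + 1)) + (x + 1) * q ≡ (x + 2) * q * (x + 1)
  collect = solve-∀

-- ((x+1+A)/(x+1))^M is antitone in x.
ratio-antitone : ∀ {x y} A M Z W → x ≤ y →
  Z * (y + 1) ^ M ≤ W * (y + 1 + A) ^ M → Z * (x + 1) ^ M ≤ W * (x + 1 + A) ^ M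
ratio-antitone {x} {y} A M Z W x≤y h = *-cancelʳ-≤ _ _ ((y + 1) ^ M) {{m^n≢0 (y + 1) M {{>-nonZero (m≤n+m 1 y)}}}} (begin
  Z * (x + 1) ^ M * (y + 1) ^ M     ≡⟨ swap Z ((x + 1) ^ M) ((y + 1) ^ M) ⟩
  Z * (y + 1) ^ M * (x + 1) ^ M     ≤⟨ *-monoˡ-≤ ((x + 1) ^ M) h ⟩
  W * (y + 1 + A) ^ M * (x + 1) ^ M ≡⟨ trans (cong (W *_) (^-distribʳ-* (y + 1 + A) (x + 1) M)) (sym (*-assoc W _ _)) ⟨
  W * ((y + 1 + A) * (x + 1)) ^ M   ≤⟨ *-monoʳ-≤ W (^-monoˡ-≤ M cross) ⟩
  W * ((x + 1 + A) * (y + 1)) ^ M   ≡⟨ trans (cong (W *_) (^-distribʳ-* (x + 1 + A) (y + 1) M)) (sym (*-assoc W _ _)) ⟩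
  W * (x + 1 + A) ^ M * (y + 1) ^ M ∎)
  where
  open ≤-Reasoning
  swap : ∀ a b c → a * b * c ≡ a * c * b
  swap = solve-∀
  cross : (y + 1 + A) * (x + 1) ≤ (x + 1 + A) * (y + 1)
  cross = begin
    (y + 1 + A) * (x + 1)          ≡⟨ expand x y A ⟩
    (y + 1) * (x + 1) + A * (x + 1) ≤⟨ +-monoʳ-≤ ((y + 1) * (x + 1)) (*-monoʳ-≤ A (+-monoˡ-≤ 1 x≤y)) ⟩
    (y + 1) * (x + 1) + A * (y + 1) ≡⟨ collect x y A ⟩
    (x + 1 + A) * (y + 1)          ∎
    where
    expand : ∀ x y A → (y + 1 + A) * (x + 1) ≡ (y + 1) * (x + 1) + A * (x + 1)
    expand = solve-∀
    collect : ∀ x y A → (y + 1) * (x + 1) + A * (y + 1) ≡ (x + 1 + A) * (y + 1)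
    collect = solve-∀

-- 1 + S/R ≤ 1 + M/k ≤ 1 + M/(x+1) ≤ ((x+2)/(x+1))^M.
growth-step : ∀ x k M R S → x + 1 ≤ k → S * k ≤ R * M → (R + S) * (x + 1) ^ M ≤ R * (x + 2) ^ M
growth-step x k M R S x<k S≤ = *-cancelʳ-≤ _ _ (x + 1) {{>-nonZero (m≤n+m 1 x)}} (begin
  (R + S) * (x + 1) ^ M * (x + 1)   ≡⟨ reorder R S ((x + 1) ^ M) (x + 1) ⟩
  (x + 1) ^ M * ((R + S) * (x + 1)) ≤⟨ *-monoʳ-≤ ((x + 1) ^ M) R+S≤ ⟩
  (x + 1) ^ M * (R * (x + 1 + M))   ≡⟨ exchange ((x + 1) ^ M) R (x + 1 + M) ⟩
  R * ((x + 1) ^ M * (x + 1 + M))   ≤⟨ *-monoʳ-≤ R (bernoulli x M) ⟩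
  R * ((x + 2) ^ M * (x + 1))       ≡⟨ *-assoc R _ _ ⟨
  R * (x + 2) ^ M * (x + 1)         ∎)
  where
  open ≤-Reasoning
  reorder : ∀ R S p a → (R + S) * p * a ≡ p * ((R + S) * a)
  reorder = solve-∀
  exchange : ∀ p R q → p * (R * q) ≡ R * (p * q)
  exchange = solve-∀
  R+S≤ : (R + S) * (x + 1) ≤ R * (x + 1 + M)
  R+S≤ = begin
    (R + S) * (x + 1)         ≡⟨ *-distribʳ-+ (x + 1) R S ⟩
    R * (x + 1) + S * (x + 1) ≤⟨ +-monoʳ-≤ (R * (x + 1)) (≤-trans (*-monoʳ-≤ S x<k) S≤) ⟩
    R * (x + 1) + R * M       ≡⟨ *-distribˡ-+ R (x + 1) M ⟨
    R * (x + 1 + M)           ∎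

module _ {n L K} (u : Fin n) (c : Row L K) where

  hasEdgeTo : Fin n → List (Edge n) → Bool
  hasEdgeTo v = any (λ e → (proj₁ e ==F u) ∧ (proj₂ e ==F v))

  outNeighbours : List (Edge n) → ℕ
  outNeighbours es = ∑[ v < n ] 𝟙 (hasEdgeTo v es)

  passingPair-absent : ∀ v es → hasEdgeTo v es ≡ false → ∀ r d → passingPair u v c r d es ≡ 0
  passingPair-absent v []             _ r d = refl
  passingPair-absent v ((a , b) ∷ es) h r d with a ==F u | b ==F v
  ... | true  | false = passingPair-absent v es h r _
  ... | false | _     = passingPair-absent v es h r _

  hasEdgeTo-fresh : ∀ b es → All (λ f → ¬ SameEdge (u , b) f) es → hasEdgeTo b es ≡ false
  hasEdgeTo-fresh b []              []           = refl
  hasEdgeTo-fresh b ((a′ , b′) ∷ es) (fresh ∷ all) with a′ ≟ᶠ u | b′ ≟ᶠ b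
  ... | yes a′≡u | yes b′≡b = ⊥-elim (fresh (inj₁ (sym a′≡u , sym b′≡b)))
  ... | yes _    | no  _    = hasEdgeTo-fresh b es all
  ... | no  _    | _        = hasEdgeTo-fresh b es all

  hasEdgeTo-loopless : ∀ es → All (λ e → proj₁ e ≢ proj₂ e) es → hasEdgeTo u es ≡ false
  hasEdgeTo-loopless []               []           = refl
  hasEdgeTo-loopless ((a′ , b′) ∷ es) (a′≢b′ ∷ all) with a′ ≟ᶠ u | b′ ≟ᶠ u
  ... | yes a′≡u | yes b′≡u = ⊥-elim (a′≢b′ (trans a′≡u (sym b′≡u)))
  ... | yes _    | no  _    = hasEdgeTo-loopless es all
  ... | no  _    | _        = hasEdgeTo-loopless es all

  private
    R M : ℕ
    R = rowCount L K
    M = K * K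

  factor : (Fin n → ℕ) → List (Edge n) → Fin n → ℕ
  factor d es v = if v ==F u then 1 else ∑[ r ∈ allRows L K ] (2 ^ passingPair u v c r d es)

  sharers : ℕ → ℕ
  sharers k = ∑[ r ∈ allRows L K ] 𝟙 (sharesFrom c r k)

  ∑-rows-1 : ∑[ r ∈ allRows L K ] 1 ≡ R
  ∑-rows-1 = trans (∑-const 1 (allRows L K)) (*-identityʳ R)

  factor-≢ : ∀ d es v → v ≢ u → factor d es v ≡ ∑[ r ∈ allRows L K ] (2 ^ passingPair u v c r d es)
  factor-≢ d es v v≢u =
    cong (λ β → if β then 1 else ∑[ r ∈ allRows L K ] (2 ^ passingPair u v c r d es)) (≢⇒==F-false v≢u)

  factor-fresh : ∀ d es v → v ≢ u → hasEdgeTo v es ≡ false → factor d es v ≡ R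
  factor-fresh d es v v≢u absent = begin
    factor d es v
      ≡⟨ factor-≢ d es v v≢u ⟩
    ∑[ r ∈ allRows L K ] (2 ^ passingPair u v c r d es)
      ≡⟨ ∑-cong (allRows L K) (λ r → cong (2 ^_) (passingPair-absent v es absent r d)) ⟩
    ∑[ r ∈ allRows L K ] 1
      ≡⟨ ∑-rows-1 ⟩
    R ∎
    where open ≡-Reasoning

  factor-other : ∀ d a b es v → a ≢ u → factor d ((a , b) ∷ es) v ≡ factor (bumpDegrees d (a , b)) es v
  factor-other d a b es v a≢u rewrite ≢⇒==F-false a≢u = refl

  factor-own : ∀ d b es v → v ≢ b → factor d ((u , b) ∷ es) v ≡ factor (bumpDegrees d (u , b)) es v
  factor-own d b es v v≢b rewrite ==F-refl u | ≢⇒==F-false (v≢b ∘ sym) = refl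

  factor-own-target : ∀ d b es → b ≢ u → hasEdgeTo b es ≡ false →
    factor d ((u , b) ∷ es) b ≡ R + sharers (level d (u , b))
  factor-own-target d b es b≢u absent = begin
    factor d ((u , b) ∷ es) b
      ≡⟨ factor-≢ d ((u , b) ∷ es) b b≢u ⟩
    ∑[ r ∈ allRows L K ] (2 ^ passingPair u b c r d ((u , b) ∷ es))
      ≡⟨ ∑-cong (allRows L K) (λ r → cong (2 ^_) (first-edge r)) ⟩
    ∑[ r ∈ allRows L K ] (2 ^ (𝟙 (S r) + 0))
      ≡⟨ ∑-cong (allRows L K) (λ r → 2^𝟙 (S r)) ⟩
    ∑[ r ∈ allRows L K ] (1 + 𝟙 (S r))
      ≡⟨ trans (∑-distrib-+ (allRows L K)) (cong (_+ sharers (level d (u , b))) ∑-rows-1) ⟩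
    R + sharers (level d (u , b)) ∎
    where
    open ≡-Reasoning
    S : Row L K → Bool
    S r = sharesFrom c r (level d (u , b))
    first-edge : ∀ r → passingPair u b c r d ((u , b) ∷ es) ≡ 𝟙 (S r) + 0
    first-edge r = trans
      (cong₂ (λ β γ → 𝟙 (β ∧ (γ ∧ S r)) + passingPair u b c r (bumpDegrees d (u , b)) es) (==F-refl u) (==F-refl b))
      (cong (𝟙 (S r) +_) (passingPair-absent b es absent r _))
    2^𝟙 : ∀ β → 2 ^ (𝟙 β + 0) ≡ 1 + 𝟙 β
    2^𝟙 true  = refl
    2^𝟙 false = refl

  outNeighbours-other : ∀ a b es → a ≢ u → outNeighbours ((a , b) ∷ es) ≡ outNeighbours es
  outNeighbours-other a b es a≢u rewrite ≢⇒==F-false a≢u = refl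

  outNeighbours-own : ∀ b es → hasEdgeTo b es ≡ false → outNeighbours ((u , b) ∷ es) ≡ outNeighbours es + 1
  outNeighbours-own b es absent rewrite ==F-refl u = begin
    ∑[ v < n ] 𝟙 ((b ==F v) ∨ hasEdgeTo v es)
      ≡⟨ sum-cong-≗ (λ v → 𝟙-∨-disjoint (b ==F v) (hasEdgeTo v es)
                             (λ b=v → trans (cong (λ w → hasEdgeTo w es) (sym (==F⇒≡ b=v))) absent)) ⟩
    ∑[ v < n ] (𝟙 (hasEdgeTo v es) + 𝟙 (b ==F v))
      ≡⟨ sum-distrib-+ (λ v → 𝟙 (hasEdgeTo v es)) (λ v → 𝟙 (b ==F v)) ⟩
    outNeighbours es + ∑[ v < n ] 𝟙 (b ==F v)
      ≡⟨ cong (outNeighbours es +_) (sum-pick b (λ _ → 1)) ⟩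
    outNeighbours es + 1 ∎
    where open ≡-Reasoning

  factor-initial : ∀ d → R * ∏ (factor d []) ≡ R ^ n
  factor-initial d = begin
    R * ∏ (factor d [])                    ≡⟨ *-comm R _ ⟩
    ∏ (factor d []) * R                    ≡⟨ cong (_* R) (∏-cong-≗ (λ v → cong (λ m → if v ==F u then 1 else m) ∑-rows-1)) ⟩
    ∏ (λ v → if v ==F u then 1 else R) * R ≡⟨ ∏-except u R ⟩
    R ^ n                                  ∎
    where open ≡-Reasoning

  -- ∏ (factor d es) / R^(n-1) is the expectation of 2^(Σᵥ passingPair u v c (row v) d es) over
  -- the rows of the other vertices; it is bounded here by ((d u + 1 + outNeighbours es) / (d u + 1))^M.
  MomentBound : (Fin n → ℕ) → List (Edge n) → Set
  MomentBound d es = R * ∏ (factor d es) * (d u + 1) ^ M ≤ R ^ n * (d u + 1 + outNeighbours es) ^ M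

  moment-initial : ∀ d → MomentBound d []
  moment-initial d = ≤-reflexive (cong₂ _*_ (factor-initial d)
    (cong (_^ M) (sym (trans (cong (d u + 1 +_) (sum-replicate-zero n)) (+-identityʳ (d u + 1))))))

  moment-other : ∀ d a b es → a ≢ u → MomentBound (bumpDegrees d (a , b)) es → MomentBound d ((a , b) ∷ es)
  moment-other d a b es a≢u ih =
    subst (λ m → R * ∏ (factor d ((a , b) ∷ es)) * (d u + 1) ^ M ≤ R ^ n * (d u + 1 + m) ^ M)
          (sym (outNeighbours-other a b es a≢u))
      (ratio-antitone (outNeighbours es) M (R * ∏ (factor d ((a , b) ∷ es))) (R ^ n) du≤d′u
        (subst (λ p → R * p * (d′ u + 1) ^ M ≤ R ^ n * (d′ u + 1 + outNeighbours es) ^ M)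
               (∏-cong-≗ (λ v → sym (factor-other d a b es v a≢u))) ih))
    where
    d′ : Fin n → ℕ
    d′ = bumpDegrees d (a , b)
    du≤d′u : d u ≤ d′ u
    du≤d′u = ≤-trans (m≤m+n (d u) _) (m≤m+n _ _)

  moment-own : ∀ d b es → b ≢ u → hasEdgeTo b es ≡ false →
    MomentBound (bumpDegrees d (u , b)) es → MomentBound d ((u , b) ∷ es)
  moment-own d b es b≢u absent ih = *-cancelʳ-≤ _ _ R {{>-nonZero (rowCount>0 L K)}} (begin
    R * ∏ f * (x + 1) ^ M * R                ≡⟨ regroup R (∏ f) ((x + 1) ^ M) ⟩
    R * (∏ f * R) * (x + 1) ^ M              ≡⟨ cong (λ p → R * p * (x + 1) ^ M) exchanged ⟩
    R * (∏ g * (R + sharers k)) * (x + 1) ^ M ≡⟨ reassoc R (∏ g) (R + sharers k) ((x + 1) ^ M) ⟩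
    R * ∏ g * ((R + sharers k) * (x + 1) ^ M) ≤⟨ *-monoʳ-≤ (R * ∏ g) growth ⟩
    R * ∏ g * (R * (x + 2) ^ M)              ≡⟨ rotate (R * ∏ g) R ((x + 2) ^ M) ⟩
    R * ∏ g * (x + 2) ^ M * R                ≤⟨ *-monoˡ-≤ R ih′ ⟩
    R ^ n * (x + 2 + A₀) ^ M * R             ≡⟨ cong (λ m → R ^ n * m ^ M * R) (shift x A₀) ⟩
    R ^ n * (x + 1 + (A₀ + 1)) ^ M * R       ≡⟨ cong (λ m → R ^ n * (x + 1 + m) ^ M * R) (outNeighbours-own b es absent) ⟨
    R ^ n * (x + 1 + outNeighbours ((u , b) ∷ es)) ^ M * R ∎)
    where
    open ≤-Reasoning
    x k A₀ : ℕ
    x = d u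
    k = level d (u , b)
    A₀ = outNeighbours es
    d′ : Fin n → ℕ
    d′ = bumpDegrees d (u , b)
    f g : Fin n → ℕ
    f = factor d ((u , b) ∷ es)
    g = factor d′ es
    d′u≡ : d′ u ≡ x + 1
    d′u≡ = trans (cong₂ (λ β γ → x + 𝟙 β + 𝟙 γ) (==F-refl u) (≢⇒==F-false (b≢u ∘ sym))) (+-identityʳ (x + 1))
    x<k : x + 1 ≤ k
    x<k = subst (_≤ k) d′u≡ (m≤m⊔n (d′ u) (d′ b))
    exchanged : ∏ f * R ≡ ∏ g * (R + sharers k)
    exchanged = begin-equality
      ∏ f * R                 ≡⟨ cong (∏ f *_) (factor-fresh d′ es b b≢u absent) ⟨
      ∏ f * g b               ≡⟨ ∏-exchange f g b (λ v v≢b → factor-own d b es v v≢b) ⟩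
      ∏ g * f b               ≡⟨ cong (∏ g *_) (factor-own-target d b es b≢u absent) ⟩
      ∏ g * (R + sharers k)   ∎
    growth : (R + sharers k) * (x + 1) ^ M ≤ R * (x + 2) ^ M
    growth = growth-step x k M R (sharers k) x<k (sharesFrom-count L K c k (≤-trans (m≤n+m 1 x) x<k))
    ih′ : R * ∏ g * (x + 2) ^ M ≤ R ^ n * (x + 2 + A₀) ^ M
    ih′ = subst (λ y → R * ∏ g * y ^ M ≤ R ^ n * (y + A₀) ^ M) (trans (cong (_+ 1) d′u≡) (+-assoc x 1 1)) ih
    regroup : ∀ r p q → r * p * q * r ≡ r * (p * r) * q
    regroup = solve-∀
    reassoc : ∀ r p s q → r * (p * s) * q ≡ r * p * (s * q)
    reassoc = solve-∀
    rotate : ∀ p r q → p * (r * q) ≡ p * q * r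
    rotate = solve-∀
    shift : ∀ x a → x + 2 + a ≡ x + 1 + (a + 1)
    shift = solve-∀

  moment-bound : ∀ d es → All (λ e → proj₁ e ≢ proj₂ e) es → AllPairs (λ e f → ¬ SameEdge e f) es →
    MomentBound d es
  moment-bound d []             _             _              = moment-initial d
  moment-bound d ((a , b) ∷ es) (a≢b ∷ loops) (fresh ∷ reps) = case a ≟ᶠ u of λ where
    (yes a≡u) → subst (λ w → MomentBound d ((w , b) ∷ es)) (sym a≡u)
                  (moment-own d b es (λ b≡u → a≢b (trans a≡u (sym b≡u)))
                    (hasEdgeTo-fresh b es (subst (λ w → All (λ f → ¬ SameEdge (w , b) f) es) a≡u fresh))
                    (moment-bound _ es loops reps))
    (no a≢u)  → moment-other d a b es a≢u (moment-bound _ es loops reps)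

outNeighbours≤n : ∀ {n L K} (u : Fin n) (c : Row L K) es → outNeighbours u c es ≤ n
outNeighbours≤n {n} u c es =
  ≤-trans (sum-mono-≤ (λ v → 𝟙≤1 (hasEdgeTo u c v es))) (≤-reflexive (trans (sum-const n 1) (*-identityʳ n)))

module _ {n L : ℕ} (es : List (Edge n)) (valid : ValidStream n L es) where
  open ValidStream valid

  private
    K M R : ℕ
    K = Klen n
    M = K * K
    R = rowCount L K
    d₀ : Fin n → ℕ
    d₀ _ = 0

  ∑-tapes-2^passingFrom : ∀ u → ∑[ P ∈ allTapes n L K ] (2 ^ passingFrom P u d₀ es) ≤ R ^ n * (n + 1) ^ M
  ∑-tapes-2^passingFrom u = *-cancelʳ-≤ _ _ R {{>-nonZero (rowCount>0 L K)}} (begin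
    ∑[ P ∈ allTapes n L K ] (2 ^ passingFrom P u d₀ es) * R
      ≡⟨ cong (_* R) (∑-cong (allTapes n L K) (λ P →
           trans (2^sum≡∏ (λ v → passingPair u v (row P u) (row P v) d₀ es)) (sym (*-identityˡ _)))) ⟩
    ∑[ P ∈ allTapes n L K ] (1 * ∏ (λ v → h (row P u) v (row P v))) * R
      ≡⟨ cong (_* R) (∑-allVec-∏-conditioned n (allRows L K) u (λ _ → 1) h h-self) ⟩
    ∑[ c ∈ allRows L K ] (1 * ∏ (factor u c d₀ es)) * R
      ≡⟨ ∑-*ʳ R _ (allRows L K) ⟩
    ∑[ c ∈ allRows L K ] (1 * ∏ (factor u c d₀ es) * R)
      ≤⟨ ∑-mono-≤ (allRows L K) per-row ⟩
    ∑[ c ∈ allRows L K ] (R ^ n * (n + 1) ^ M)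
      ≡⟨ trans (∑-const _ (allRows L K)) (*-comm R _) ⟩
    R ^ n * (n + 1) ^ M * R ∎)
    where
    open ≤-Reasoning
    h : Row L K → Fin n → Row L K → ℕ
    h c v r = 2 ^ passingPair u v c r d₀ es
    h-self : ∀ c r → h c u r ≡ 1
    h-self c r = cong (2 ^_) (passingPair-absent u c u es (hasEdgeTo-loopless u c es noLoops) r d₀)
    per-row : ∀ c → 1 * ∏ (factor u c d₀ es) * R ≤ R ^ n * (n + 1) ^ M
    per-row c = begin
      1 * ∏ (factor u c d₀ es) * R               ≡⟨ rearrange R (∏ (factor u c d₀ es)) ⟩
      R * ∏ (factor u c d₀ es) * 1               ≡⟨ cong (R * ∏ (factor u c d₀ es) *_) (^-zeroˡ M) ⟨
      R * ∏ (factor u c d₀ es) * (0 + 1) ^ M     ≤⟨ moment-bound u c d₀ es noLoops noRepeat ⟩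
      R ^ n * (0 + 1 + outNeighbours u c es) ^ M ≤⟨ *-monoʳ-≤ (R ^ n) (^-monoˡ-≤ M (s≤s (outNeighbours≤n u c es))) ⟩
      R ^ n * (1 + n) ^ M                        ≡⟨ cong (λ m → R ^ n * m ^ M) (+-comm 1 n) ⟩
      R ^ n * (n + 1) ^ M                        ∎
      where
      rearrange : ∀ r p → 1 * p * r ≡ r * p * 1
      rearrange = solve-∀

  bad-tape≤∑ : ∀ (P : Tape n L K) m →
    𝟙 (n * m <ᵇ storedEdges P es) * 2 ^ m ≤ ∑[ u < n ] (2 ^ passingFrom P u d₀ es)
  bad-tape≤∑ P m with n * m <ᵇ storedEdges P es in eq
  ... | false = z≤n
  ... | true  = begin
    1 * 2 ^ m                           ≡⟨ *-identityˡ (2 ^ m) ⟩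
    2 ^ m                               ≤⟨ ^-monoʳ-≤ 2 (<⇒≤ m<) ⟩
    2 ^ passingFrom P u d₀ es           ≤⟨ entry≤sum (λ v → 2 ^ passingFrom P v d₀ es) u ⟩
    ∑[ v < n ] (2 ^ passingFrom P v d₀ es) ∎
    where
    open ≤-Reasoning
    n*m<stored : n * m < storedEdges P es
    n*m<stored = <ᵇ⇒< (n * m) (storedEdges P es) (subst T (sym eq) _)
    n*m<∑ : n * m < ∑[ v < n ] passingFrom P v d₀ es
    n*m<∑ = <-≤-trans n*m<stored (≤-trans (storedEdges≤passingCount P es) (≤-reflexive (passingCount≡∑passingFrom P d₀ es)))
    u : Fin n
    u = proj₁ (pigeonhole (λ v → passingFrom P v d₀ es) m n*m<∑)
    m< : m < passingFrom P u d₀ es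
    m< = proj₂ (pigeonhole (λ v → passingFrom P v d₀ es) m n*m<∑)

  badCount-markov : ∀ m → badCount n L es (n * m) * 2 ^ m ≤ n * (R ^ n * (n + 1) ^ M)
  badCount-markov m = begin
    badCount n L es (n * m) * 2 ^ m
      ≡⟨ cong (_* 2 ^ m) (length-filterᵇ≡∑ (λ P → n * m <ᵇ storedEdges P es) (allTapes n L K)) ⟩
    (∑[ P ∈ allTapes n L K ] 𝟙 (n * m <ᵇ storedEdges P es)) * 2 ^ m
      ≡⟨ ∑-*ʳ (2 ^ m) _ (allTapes n L K) ⟩
    ∑[ P ∈ allTapes n L K ] (𝟙 (n * m <ᵇ storedEdges P es) * 2 ^ m)
      ≤⟨ ∑-mono-≤ (allTapes n L K) (λ P → bad-tape≤∑ P m) ⟩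
    ∑[ P ∈ allTapes n L K ] ∑[ u < n ] (2 ^ passingFrom P u d₀ es)
      ≡⟨ ∑-sum-comm (λ u P → 2 ^ passingFrom P u d₀ es) (allTapes n L K) ⟨
    ∑[ u < n ] ∑[ P ∈ allTapes n L K ] (2 ^ passingFrom P u d₀ es)
      ≤⟨ sum-mono-≤ ∑-tapes-2^passingFrom ⟩
    ∑[ u < n ] (R ^ n * (n + 1) ^ M)
      ≡⟨ sum-const n _ ⟩
    n * (R ^ n * (n + 1) ^ M) ∎
    where open ≤-Reasoning

  badCount*n≤totalCount : ∀ m → n * n * (n + 1) ^ M ≤ 2 ^ m → badCount n L es (n * m) * n ≤ totalCount n L
  badCount*n≤totalCount m n²[n+1]^M≤2^m = *-cancelʳ-≤ _ _ (2 ^ m) {{m^n≢0 2 m}} (begin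
    bad * n * 2 ^ m              ≡⟨ reorder bad n (2 ^ m) ⟩
    n * (bad * 2 ^ m)            ≤⟨ *-monoʳ-≤ n (badCount-markov m) ⟩
    n * (n * (R ^ n * (n + 1) ^ M)) ≡⟨ regroup n (R ^ n) ((n + 1) ^ M) ⟩
    n * n * (n + 1) ^ M * R ^ n  ≤⟨ *-monoˡ-≤ (R ^ n) n²[n+1]^M≤2^m ⟩
    2 ^ m * R ^ n                ≡⟨ cong (2 ^ m *_) (length-allVec (allRows L K) n) ⟨
    2 ^ m * totalCount n L       ≡⟨ *-comm (2 ^ m) _ ⟩
    totalCount n L * 2 ^ m       ∎)
    where
    open ≤-Reasoning
    bad : ℕ
    bad = badCount n L es (n * m)
    reorder : ∀ a b c → a * b * c ≡ b * (a * c)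
    reorder = solve-∀
    regroup : ∀ a b c → a * (a * (b * c)) ≡ a * a * c * b
    regroup = solve-∀

n≤2^⌈log2⌉ : ∀ n (rec : Acc _<_ n) → n ≤ 2 ^ ⌈log2⌉ n rec
n≤2^⌈log2⌉ zero          _        = z≤n
n≤2^⌈log2⌉ (suc zero)    _        = s≤s z≤n
n≤2^⌈log2⌉ (suc (suc n)) (acc rs) = begin
  suc (suc n)                   ≤⟨ s≤s (s≤s n≤2⌈n/2⌉) ⟩
  suc (suc (⌈ n /2⌉ + ⌈ n /2⌉)) ≡⟨ cong suc (+-suc ⌈ n /2⌉ ⌈ n /2⌉) ⟨
  suc ⌈ n /2⌉ + suc ⌈ n /2⌉     ≤⟨ +-mono-≤ ih ih ⟩
  2 ^ h + 2 ^ h                 ≡⟨ cong (2 ^ h +_) (+-identityʳ (2 ^ h)) ⟨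
  2 ^ suc h                     ∎
  where
  open ≤-Reasoning
  h : ℕ
  h = ⌈log2⌉ (suc ⌈ n /2⌉) (rs (⌈n/2⌉<n n))
  ih : suc ⌈ n /2⌉ ≤ 2 ^ h
  ih = n≤2^⌈log2⌉ (suc ⌈ n /2⌉) (rs (⌈n/2⌉<n n))
  n≤2⌈n/2⌉ : n ≤ ⌈ n /2⌉ + ⌈ n /2⌉
  n≤2⌈n/2⌉ = subst (_≤ ⌈ n /2⌉ + ⌈ n /2⌉) (⌊n/2⌋+⌈n/2⌉≡n n) (+-monoˡ-≤ _ (⌊n/2⌋≤⌈n/2⌉ n))

n≤2^⌈log₂n⌉ : ∀ n → n ≤ 2 ^ ⌈log₂ n ⌉
n≤2^⌈log₂n⌉ n = n≤2^⌈log2⌉ n (<-wellFounded n)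

-- With ℓ = ⌈log₂ n⌉: n ≤ 2^ℓ, n + 1 ≤ 2^(2ℓ) and Klen n = 4ℓ.
n²[n+1]^Klen²≤2^34ℓ³ : ∀ n → 2 ≤ n → n * n * (n + 1) ^ (Klen n * Klen n) ≤ 2 ^ (34 * ⌈log₂ n ⌉ ^ 3)
n²[n+1]^Klen²≤2^34ℓ³ n 2≤n = begin
  n * n * (n + 1) ^ M              ≤⟨ *-mono-≤ (*-mono-≤ n≤p n≤p) (^-monoˡ-≤ M n+1≤) ⟩
  p * p * (2 ^ (ℓ + ℓ)) ^ M        ≡⟨ cong (p * p *_) (^-*-assoc 2 (ℓ + ℓ) M) ⟩
  p * p * 2 ^ ((ℓ + ℓ) * M)        ≡⟨ cong (_* 2 ^ ((ℓ + ℓ) * M)) (^-distribˡ-+-* 2 ℓ ℓ) ⟨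
  2 ^ (ℓ + ℓ) * 2 ^ ((ℓ + ℓ) * M)  ≡⟨ ^-distribˡ-+-* 2 (ℓ + ℓ) _ ⟨
  2 ^ (ℓ + ℓ + (ℓ + ℓ) * M)        ≤⟨ ^-monoʳ-≤ 2 exponent ⟩
  2 ^ (34 * ℓ ^ 3)                 ∎
  where
  open ≤-Reasoning
  ℓ p M : ℕ
  ℓ = ⌈log₂ n ⌉
  p = 2 ^ ℓ
  M = Klen n * Klen n
  1≤ℓ : 1 ≤ ℓ
  1≤ℓ = subst (_≤ ℓ) (⌈log₂2^n⌉≡n 1) (⌈log₂⌉-mono-≤ 2≤n)
  n≤p : n ≤ p
  n≤p = n≤2^⌈log₂n⌉ n
  n+1≤ : n + 1 ≤ 2 ^ (ℓ + ℓ)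
  n+1≤ = begin
    n + 1           ≤⟨ +-mono-≤ n≤p (m^n>0 2 ℓ) ⟩
    p + p           ≡⟨ cong (p +_) (+-identityʳ p) ⟨
    2 ^ suc ℓ       ≤⟨ ^-monoʳ-≤ 2 (subst (_≤ ℓ + ℓ) (+-comm ℓ 1) (+-monoʳ-≤ ℓ 1≤ℓ)) ⟩
    2 ^ (ℓ + ℓ)     ∎
  ℓ≤ℓ³ : ℓ ≤ ℓ ^ 3
  ℓ≤ℓ³ = begin
    ℓ               ≡⟨ *-identityʳ ℓ ⟨
    ℓ * 1           ≤⟨ *-monoʳ-≤ ℓ (*-mono-≤ 1≤ℓ (*-mono-≤ 1≤ℓ (≤-refl {1}))) ⟩
    ℓ ^ 3           ∎
  exponent : ℓ + ℓ + (ℓ + ℓ) * M ≤ 34 * ℓ ^ 3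
  exponent = begin
    ℓ + ℓ + (ℓ + ℓ) * M          ≡⟨ expand ℓ ⟩
    ℓ + ℓ + 32 * ℓ ^ 3           ≤⟨ +-monoˡ-≤ (32 * ℓ ^ 3) (+-mono-≤ ℓ≤ℓ³ ℓ≤ℓ³) ⟩
    ℓ ^ 3 + ℓ ^ 3 + 32 * ℓ ^ 3   ≡⟨ collect ℓ ⟩
    34 * ℓ ^ 3                   ∎
    where
    expand : ∀ l → l + l + (l + l) * ((4 * l) * (4 * l)) ≡ l + l + 32 * (l * (l * (l * 1)))
    expand = solve-∀
    collect : ∀ l → l * (l * (l * 1)) + l * (l * (l * 1)) + 32 * (l * (l * (l * 1))) ≡ 34 * (l * (l * (l * 1)))
    collect = solve-∀

lemma5p4 : Σ ℕ λ C → Σ ℕ λ d → Σ ℕ λ n₀ → (1 ≤ d) ×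
    (∀ n L (es : List (Fin n × Fin n)) → n₀ ≤ n → ValidStream n L es →
    badCount n L es (C * n * ⌈log₂ n ⌉ ^ 3) * n ^ d ≤ totalCount n L)
lemma5p4 = 34 , 1 , 2 , s≤s z≤n , λ n L es 2≤n valid →
  subst₂ (λ B k → badCount n L es B * k ≤ totalCount n L)
    (reassoc n ⌈log₂ n ⌉) (sym (*-identityʳ n))
    (badCount*n≤totalCount es valid (34 * ⌈log₂ n ⌉ ^ 3) (n²[n+1]^Klen²≤2^34ℓ³ n 2≤n))
  where
  reassoc : ∀ n l → n * (34 * (l * (l * (l * 1)))) ≡ 34 * n * (l * (l * (l * 1)))
  reassoc = solve-∀
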